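{- Let $S$ be any proper, nonempty subset of $[n-1]$, and let $\bar S=[n-1]\setminus S$. Then \[\max\{d_\ell(\sigma,\rho):\sigma,\rho\in\mathcal{D}(S;n),\ \sigma\ne\rho\}=\max\{d_\ell(\sigma,\rho):\sigma,\rho\in\mathcal{D}(\bar S;n),\ \sigma\ne\rho\}.\]
   Context: $S_n$ is the symmetric group on $[n]=\{1,\ldots,n\}$, with permutations in one-line notation $\sigma=\sigma_1\cdots\sigma_n$. The descent set of $\sigma$ is $\mathcal{D}(\sigma)=\{j\in[n-1]:\sigma_j>\sigma_{j+1}\}$, and for $S\subseteq[n-1]$, $\mathcal{D}(S;n)=\{\sigma\in S_n:\mathcal{D}(\sigma)=S\}$. The $\ell_\infty$-metric is $d_\ell(\sigma,\rho)=\max\{|\sigma_j-\rho_j|:1\le j\le n\}$. -}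

module Defs where

open import Data.Nat using (ℕ; zero; suc; _⊔_; _≤_; ∣_-_∣)
open import Data.Fin using (Fin; toℕ; inject₁; _>_) renaming (suc to fsuc)
open import Data.Fin.Permutation using (Permutation′; _⟨$⟩ʳ_)
open import Data.Fin.Subset using (Subset; _∈_)
open import Data.List using (List; foldr; map)
open import Data.List using (allFin)
open import Data.Product using (_×_; Σ)
open import Relation.Binary.PropositionalEquality using (_≡_)
open import Relation.Nullary using (¬_)

-- Permutations of [n], n = suc m, realised as bijections of Fin (suc m);
-- the entry σ_j is (toℕ (σ ⟨$⟩ʳ j)) + 1 (the shift is irrelevant below).

-- Descent at position j ∈ [m] = [n-1]: the position j is encoded by
-- (i : Fin m) with j = toℕ i + 1, and compares σ at inject₁ i and fsuc i.
IsDescent : ∀ {m} → Permutation′ (suc m) → Fin m → Set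
IsDescent σ i = (σ ⟨$⟩ʳ inject₁ i) > (σ ⟨$⟩ʳ fsuc i)

HasDescentSet : ∀ {m} → Subset m → Permutation′ (suc m) → Set
HasDescentSet S σ = ∀ i → (i ∈ S → IsDescent σ i) × (IsDescent σ i → i ∈ S)

dℓ : ∀ {n} → Permutation′ n → Permutation′ n → ℕ
dℓ {n} σ ρ = foldr _⊔_ 0 (map (λ j → ∣ toℕ (σ ⟨$⟩ʳ j) - toℕ (ρ ⟨$⟩ʳ j) ∣) (allFin n))

_≢ₚ_ : ∀ {n} → Permutation′ n → Permutation′ n → Set
σ ≢ₚ ρ = ¬ (∀ j → σ ⟨$⟩ʳ j ≡ ρ ⟨$⟩ʳ j)

IsMaxDist : ∀ {m} → Subset m → ℕ → Set
IsMaxDist {m} S k =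
  (Σ (Permutation′ (suc m)) λ σ → Σ (Permutation′ (suc m)) λ ρ →
     HasDescentSet S σ × HasDescentSet S ρ × σ ≢ₚ ρ × dℓ σ ρ ≡ k)
  × (∀ (σ ρ : Permutation′ (suc m)) → HasDescentSet S σ → HasDescentSet S ρ →
       σ ≢ₚ ρ → dℓ σ ρ ≤ k)

{-# OPTIONS --safe #-}
-- The complement σ ↦ σᶜ, σᶜ_j = n + 1 − σ_j, turns descents into ascents and
-- vice versa, so it is a bijection D(S;n) → D(S̄;n); it also preserves every
-- |σ_j − ρ_j|, hence the ℓ∞-distance, so both maxima range over the same set of
-- distances. For the maxima to exist, D(S;n) needs two elements, which holds as
-- S is proper and nonempty, and the search over permutations must be finite and
-- decidable: every permutation is its first value followed by a permutation of
-- the remaining n − 1 values.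
module Submission where

open import Data.Fin.Base using (Fin; toℕ; inject₁; fromℕ; opposite; punchIn; _>_)
  renaming (zero to fzero; suc to fsuc)
import Data.Fin.Properties as Finₚ
open import Data.Fin.Permutation
  using ( Permutation′; _⟨$⟩ʳ_; _⟨$⟩ˡ_; _≈_; _∘ₚ_; id; reverse; insert; remove; inverseˡ
        ; insert-punchIn; insert-remove)
open import Data.Fin.Subset using (Subset; Side; inside; outside; _∈_; _∉_; ∁; Nonempty)
open import Data.Fin.Subset.Properties using (_∈?_; x∈∁p⇒x∉p; x∉p⇒x∈∁p; x∈p⇒x∉∁p; x∉∁p⇒x∈p)
open import Data.List.Base using (foldr; allFin)
open import Data.List.Properties using (map-cong; foldr-preservesᵇ)
open import Data.List.Relation.Unary.All using (universal)
open import Data.List.Relation.Unary.All.Properties using (map⁺)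
open import Data.Nat.Base using (ℕ; zero; suc; _≤_; _<_; _∸_; _⊔_; ∣_-_∣; z≤n; s≤s; s≤s⁻¹)
import Data.Nat.Properties as ℕₚ
open import Data.Product.Base using (_×_; ∃; ∃₂; _,_; proj₁; proj₂)
open import Data.Vec.Base using ([]; _∷_; here; there)
open import Function.Base using (_∘_)
open import Level using (Level)
open import Relation.Binary.Definitions using (_Respects_)
open import Relation.Binary.PropositionalEquality
  using (_≡_; _≢_; refl; sym; trans; cong; cong₂; subst; subst₂; module ≡-Reasoning)
open import Relation.Nullary using (¬_; Dec; yes; no; contradiction)
open import Relation.Nullary.Decidable using (map′; ¬?; _×-dec_; _→-dec_)
open import Relation.Unary using (Pred; Decidable)

open import Defs

private
  variable
    p : Level
    m n : ℕ

∣m∸n-m∸o∣≡∣n-o∣ : ∀ {m n o} → n ≤ m → o ≤ m → ∣ m ∸ n - m ∸ o ∣ ≡ ∣ n - o ∣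
∣m∸n-m∸o∣≡∣n-o∣ {m} {zero}  {o}     _         o≤m       =
  trans (ℕₚ.m≤n⇒∣n-m∣≡n∸m (ℕₚ.m∸n≤m m o)) (ℕₚ.m∸[m∸n]≡n o≤m)
∣m∸n-m∸o∣≡∣n-o∣ {m} {suc n} {zero}  n≤m       _         =
  trans (ℕₚ.∣-∣-comm (m ∸ suc n) m) (∣m∸n-m∸o∣≡∣n-o∣ z≤n n≤m)
∣m∸n-m∸o∣≡∣n-o∣ {suc m} {suc n} {suc o} (s≤s n≤m) (s≤s o≤m) = ∣m∸n-m∸o∣≡∣n-o∣ n≤m o≤m

module _ {P : Pred ℕ p} (P? : Decidable P) where

  private
    below : ∀ {t} → ¬ P t → (∀ {k} → P k → k ≤ t) → ∀ {k} → P k → k < t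
    below ¬Pt bound Pk = ℕₚ.≤∧≢⇒< (bound Pk) λ { refl → ¬Pt Pk }

  greatest : ∀ t → (∀ {k} → P k → k ≤ t) → ∃ P → ∃ λ k → P k × (∀ {j} → P j → j ≤ k)
  greatest t bound (k , Pk) with P? t
  ... | yes Pt = t , Pt , bound
  greatest zero    bound (k , Pk) | no ¬Pt = contradiction (below ¬Pt bound Pk) ℕₚ.n≮0
  greatest (suc t) bound (k , Pk) | no ¬Pt = greatest t (s≤s⁻¹ ∘ below ¬Pt bound) (k , Pk)

insert-cong : (v : Fin (suc n)) {σ ρ : Permutation′ n} → σ ≈ ρ → insert fzero v σ ≈ insert fzero v ρ
insert-cong v         σ≈ρ fzero    = refl
insert-cong v {σ} {ρ} σ≈ρ (fsuc k) = begin
  insert fzero v σ ⟨$⟩ʳ fsuc k  ≡⟨ insert-punchIn fzero v σ k ⟩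
  punchIn v (σ ⟨$⟩ʳ k)          ≡⟨ cong (punchIn v) (σ≈ρ k) ⟩
  punchIn v (ρ ⟨$⟩ʳ k)          ≡⟨ insert-punchIn fzero v ρ k ⟨
  insert fzero v ρ ⟨$⟩ʳ fsuc k  ∎
  where open ≡-Reasoning

∃-permutation? : {P : Pred (Permutation′ n) p} → P Respects _≈_ → Decidable P → Dec (∃ P)
∃-permutation? {zero}  resp P? = map′ (id ,_) (λ (σ , Pσ) → resp (λ ()) Pσ) (P? id)
∃-permutation? {suc n} resp P? =
  map′ (λ (v , τ , P[v∷τ]) → insert fzero v τ , P[v∷τ])
       (λ (σ , Pσ) → σ ⟨$⟩ʳ fzero , remove fzero σ , resp (sym ∘ insert-remove fzero σ) Pσ)
       (Finₚ.any? λ v → ∃-permutation? (resp ∘ insert-cong v) (P? ∘ insert fzero v))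

∃₂-permutation? : {P : Permutation′ n → Permutation′ n → Set p} →
                  (∀ {σ σ′ ρ ρ′} → σ ≈ σ′ → ρ ≈ ρ′ → P σ ρ → P σ′ ρ′) →
                  (∀ σ ρ → Dec (P σ ρ)) → Dec (∃₂ P)
∃₂-permutation? resp P? =
  ∃-permutation? (λ σ≈σ′ (ρ , Pσρ) → ρ , resp σ≈σ′ (λ _ → refl) Pσρ) λ σ →
  ∃-permutation? (resp (λ _ → refl)) (P? σ)

isDescent? : (σ : Permutation′ (suc m)) → Decidable (IsDescent σ)
isDescent? σ i = σ ⟨$⟩ʳ fsuc i Finₚ.<? σ ⟨$⟩ʳ inject₁ i

hasDescentSet? : (S : Subset m) → Decidable (HasDescentSet S)
hasDescentSet? S σ = Finₚ.all? λ i →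
  ((i ∈? S) →-dec isDescent? σ i) ×-dec (isDescent? σ i →-dec (i ∈? S))

_≢ₚ?_ : (σ ρ : Permutation′ n) → Dec (σ ≢ₚ ρ)
σ ≢ₚ? ρ = ¬? (Finₚ.all? λ j → σ ⟨$⟩ʳ j Finₚ.≟ ρ ⟨$⟩ʳ j)

isDescent-resp-≈ : {σ ρ : Permutation′ (suc m)} → σ ≈ ρ → ∀ {i} → IsDescent σ i → IsDescent ρ i
isDescent-resp-≈ σ≈ρ {i} = subst₂ _>_ (σ≈ρ (inject₁ i)) (σ≈ρ (fsuc i))

hasDescentSet-resp-≈ : (S : Subset m) → HasDescentSet S Respects _≈_
hasDescentSet-resp-≈ S {σ} {ρ} σ≈ρ hd i =
  isDescent-resp-≈ {σ = σ} {ρ} σ≈ρ ∘ proj₁ (hd i) ,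
  proj₂ (hd i) ∘ isDescent-resp-≈ {σ = ρ} {σ} (sym ∘ σ≈ρ)

≢ₚ-resp-≈ : {σ σ′ ρ ρ′ : Permutation′ n} → σ ≈ σ′ → ρ ≈ ρ′ → σ ≢ₚ ρ → σ′ ≢ₚ ρ′
≢ₚ-resp-≈ σ≈σ′ ρ≈ρ′ σ≢ρ σ′≈ρ′ = σ≢ρ λ j → trans (σ≈σ′ j) (trans (σ′≈ρ′ j) (sym (ρ≈ρ′ j)))

dℓ-cong : {σ σ′ ρ ρ′ : Permutation′ n} →
          (∀ j → ∣ toℕ (σ ⟨$⟩ʳ j) - toℕ (ρ ⟨$⟩ʳ j) ∣ ≡ ∣ toℕ (σ′ ⟨$⟩ʳ j) - toℕ (ρ′ ⟨$⟩ʳ j) ∣) →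
          dℓ σ ρ ≡ dℓ σ′ ρ′
dℓ-cong {n} eq = cong (foldr _⊔_ 0) (map-cong eq (allFin n))

dℓ-resp-≈ : {σ σ′ ρ ρ′ : Permutation′ n} → σ ≈ σ′ → ρ ≈ ρ′ → dℓ σ ρ ≡ dℓ σ′ ρ′
dℓ-resp-≈ {σ = σ} {σ′} {ρ} {ρ′} σ≈σ′ ρ≈ρ′ = dℓ-cong {σ = σ} {σ′} {ρ} {ρ′} λ j →
  cong₂ (λ a b → ∣ toℕ a - toℕ b ∣) (σ≈σ′ j) (ρ≈ρ′ j)

dℓ≤pred[n] : (σ ρ : Permutation′ (suc m)) → dℓ σ ρ ≤ m
dℓ≤pred[n] {m} σ ρ =
  foldr-preservesᵇ {P = _≤ m} ℕₚ.⊔-lub z≤n (map⁺ (universal entry≤m (allFin (suc m))))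
  where
  entry≤m : ∀ j → ∣ toℕ (σ ⟨$⟩ʳ j) - toℕ (ρ ⟨$⟩ʳ j) ∣ ≤ m
  entry≤m j = ℕₚ.≤-trans (ℕₚ.∣m-n∣≤m⊔n (toℕ (σ ⟨$⟩ʳ j)) (toℕ (ρ ⟨$⟩ʳ j)))
                         (ℕₚ.⊔-lub (Finₚ.toℕ≤pred[n] (σ ⟨$⟩ʳ j)) (Finₚ.toℕ≤pred[n] (ρ ⟨$⟩ʳ j)))

DistanceWitness : Subset m → ℕ → Permutation′ (suc m) → Permutation′ (suc m) → Set
DistanceWitness S k σ ρ = HasDescentSet S σ × HasDescentSet S ρ × σ ≢ₚ ρ × dℓ σ ρ ≡ k

Attained : Subset m → ℕ → Set
Attained S k = ∃₂ (DistanceWitness S k)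

distanceWitness-resp-≈ : (S : Subset m) {k : ℕ} {σ σ′ ρ ρ′ : Permutation′ (suc m)} →
                         σ ≈ σ′ → ρ ≈ ρ′ → DistanceWitness S k σ ρ → DistanceWitness S k σ′ ρ′
distanceWitness-resp-≈ S {σ = σ} {σ′} {ρ} {ρ′} σ≈σ′ ρ≈ρ′ (hσ , hρ , σ≢ρ , dist) =
  hasDescentSet-resp-≈ S {σ} {σ′} σ≈σ′ hσ , hasDescentSet-resp-≈ S {ρ} {ρ′} ρ≈ρ′ hρ ,
  ≢ₚ-resp-≈ {σ = σ} {σ′} {ρ} {ρ′} σ≈σ′ ρ≈ρ′ σ≢ρ ,
  trans (sym (dℓ-resp-≈ {σ = σ} {σ′} {ρ} {ρ′} σ≈σ′ ρ≈ρ′)) dist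

attained? : (S : Subset m) → Decidable (Attained S)
attained? S k =
  ∃₂-permutation? (λ {σ} {σ′} {ρ} {ρ′} → distanceWitness-resp-≈ S {k} {σ} {σ′} {ρ} {ρ′}) λ σ ρ →
    hasDescentSet? S σ ×-dec hasDescentSet? S ρ ×-dec σ ≢ₚ? ρ ×-dec dℓ σ ρ ℕₚ.≟ k

complement : Permutation′ n → Permutation′ n
complement σ = σ ∘ₚ reverse

opposite-< : {i j : Fin n} → toℕ i < toℕ j → toℕ (opposite j) < toℕ (opposite i)
opposite-< {i = i} {j} i<j = subst₂ _<_ (sym (Finₚ.opposite-prop j)) (sym (Finₚ.opposite-prop i))
  (ℕₚ.∸-monoʳ-< (s≤s i<j) (Finₚ.toℕ<n j))

opposite-cancel-< : {i j : Fin n} → toℕ (opposite j) < toℕ (opposite i) → toℕ i < toℕ j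
opposite-cancel-< {i = i} {j} lt =
  subst₂ _<_ (cong toℕ (Finₚ.opposite-involutive i)) (cong toℕ (Finₚ.opposite-involutive j))
    (opposite-< lt)

inject₁≢suc : (i : Fin n) → inject₁ i ≢ fsuc i
inject₁≢suc fzero    ()
inject₁≢suc (fsuc i) = inject₁≢suc i ∘ Finₚ.suc-injective

⟨$⟩ʳ-injective : (σ : Permutation′ n) {i j : Fin n} → σ ⟨$⟩ʳ i ≡ σ ⟨$⟩ʳ j → i ≡ j
⟨$⟩ʳ-injective σ eq = trans (sym (inverseˡ σ)) (trans (cong (σ ⟨$⟩ˡ_) eq) (inverseˡ σ))

complement-isDescent : (σ : Permutation′ (suc m)) {i : Fin m} →
                       ¬ IsDescent σ i → IsDescent (complement σ) i
complement-isDescent σ {i} ¬desc =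
  opposite-< (ℕₚ.≤∧≢⇒< (ℕₚ.≮⇒≥ ¬desc) (inject₁≢suc i ∘ ⟨$⟩ʳ-injective σ ∘ Finₚ.toℕ-injective))

isDescent-complement : (σ : Permutation′ (suc m)) {i : Fin m} →
                       IsDescent (complement σ) i → ¬ IsDescent σ i
isDescent-complement σ desc = ℕₚ.<-asym (opposite-cancel-< desc)

Complementary : Subset m → Subset m → Set
Complementary S T = (∀ {i} → i ∈ T → i ∉ S) × (∀ {i} → i ∉ S → i ∈ T)

hasDescentSet-complement : {S T : Subset m} → Complementary S T → (σ : Permutation′ (suc m)) →
                           HasDescentSet S σ → HasDescentSet T (complement σ)
hasDescentSet-complement (T⇒∉S , ∉S⇒T) σ hd i =
  (λ i∈T → complement-isDescent σ (T⇒∉S i∈T ∘ proj₂ (hd i))) ,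
  (λ desc → ∉S⇒T (isDescent-complement σ desc ∘ proj₁ (hd i)))

complement-≢ₚ : (σ ρ : Permutation′ n) → σ ≢ₚ ρ → complement σ ≢ₚ complement ρ
complement-≢ₚ σ ρ σ≢ρ σᶜ≈ρᶜ = σ≢ρ λ j →
  subst₂ _≡_ (Finₚ.opposite-involutive _) (Finₚ.opposite-involutive _) (cong opposite (σᶜ≈ρᶜ j))

∣opposite-opposite∣≡∣i-j∣ : (i j : Fin n) →
                            ∣ toℕ (opposite i) - toℕ (opposite j) ∣ ≡ ∣ toℕ i - toℕ j ∣
∣opposite-opposite∣≡∣i-j∣ {n} i j = begin
  ∣ toℕ (opposite i) - toℕ (opposite j) ∣
    ≡⟨ cong₂ ∣_-_∣ (Finₚ.opposite-prop i) (Finₚ.opposite-prop j) ⟩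
  ∣ n ∸ suc (toℕ i) - n ∸ suc (toℕ j) ∣
    ≡⟨ ∣m∸n-m∸o∣≡∣n-o∣ (Finₚ.toℕ<n i) (Finₚ.toℕ<n j) ⟩
  ∣ toℕ i - toℕ j ∣
    ∎
  where open ≡-Reasoning

dℓ-complement : (σ ρ : Permutation′ n) → dℓ (complement σ) (complement ρ) ≡ dℓ σ ρ
dℓ-complement σ ρ = dℓ-cong {σ = complement σ} {σ} {complement ρ} {ρ} λ j →
  ∣opposite-opposite∣≡∣i-j∣ (σ ⟨$⟩ʳ j) (ρ ⟨$⟩ʳ j)

complement-distanceWitness : {S T : Subset m} {k : ℕ} → Complementary S T →
                             {σ ρ : Permutation′ (suc m)} → DistanceWitness S k σ ρ →
                             DistanceWitness T k (complement σ) (complement ρ)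
complement-distanceWitness S∁T {σ} {ρ} (hσ , hρ , σ≢ρ , dist) =
  hasDescentSet-complement S∁T σ hσ , hasDescentSet-complement S∁T ρ hρ ,
  complement-≢ₚ σ ρ σ≢ρ , trans (dℓ-complement σ ρ) dist

∁-complementary : (S : Subset m) → Complementary S (∁ S)
∁-complementary S = x∈∁p⇒x∉p , x∉p⇒x∈∁p

complementary-∁ : (S : Subset m) → Complementary (∁ S) S
complementary-∁ S = x∈p⇒x∉∁p , x∉∁p⇒x∈p

isMaxDist-∁ : (S : Subset m) {k : ℕ} → IsMaxDist S k → IsMaxDist (∁ S) k
isMaxDist-∁ S ((σ , ρ , w) , maximal) =
  (complement σ , complement ρ , complement-distanceWitness (∁-complementary S) {σ} {ρ} w) ,
  λ τ π hτ hπ τ≢π → subst (_≤ _) (dℓ-complement τ π)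
    (maximal (complement τ) (complement π) (hasDescentSet-complement (complementary-∁ S) τ hτ)
             (hasDescentSet-complement (complementary-∁ S) π hπ) (complement-≢ₚ τ π τ≢π))

punchIn-mono-< : (v : Fin (suc n)) {i j : Fin n} →
                 toℕ i < toℕ j → toℕ (punchIn v i) < toℕ (punchIn v j)
punchIn-mono-< v {i} {j} i<j = ℕₚ.≰⇒> λ vj≤vi → ℕₚ.<⇒≱ i<j (Finₚ.punchIn-cancel-≤ v j i vj≤vi)

punchIn-cancel-< : (v : Fin (suc n)) {i j : Fin n} →
                   toℕ (punchIn v i) < toℕ (punchIn v j) → toℕ i < toℕ j
punchIn-cancel-< v {i} {j} vi<vj = ℕₚ.≰⇒> λ j≤i → ℕₚ.<⇒≱ vi<vj (Finₚ.punchIn-mono-≤ v j i j≤i)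

insert-isDescent : (v : Fin (suc (suc m))) (τ : Permutation′ (suc m)) {i : Fin m} →
                   IsDescent τ i → IsDescent (insert fzero v τ) (fsuc i)
insert-isDescent v τ {i} desc =
  subst₂ _>_ (sym (insert-punchIn fzero v τ (inject₁ i))) (sym (insert-punchIn fzero v τ (fsuc i)))
    (punchIn-mono-< v desc)

isDescent-insert : (v : Fin (suc (suc m))) (τ : Permutation′ (suc m)) {i : Fin m} →
                   IsDescent (insert fzero v τ) (fsuc i) → IsDescent τ i
isDescent-insert v τ {i} desc = punchIn-cancel-< v
  (subst₂ _>_ (insert-punchIn fzero v τ (inject₁ i)) (insert-punchIn fzero v τ (fsuc i)) desc)

hasDescentSet-insert : {S : Subset m} {b : Side} (v : Fin (suc (suc m))) (τ : Permutation′ (suc m)) →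
                       (fzero ∈ b ∷ S → v > punchIn v (τ ⟨$⟩ʳ fzero)) →
                       (v > punchIn v (τ ⟨$⟩ʳ fzero) → fzero ∈ b ∷ S) →
                       HasDescentSet S τ → HasDescentSet (b ∷ S) (insert fzero v τ)
hasDescentSet-insert v τ first⇒desc desc⇒first hd fzero =
  subst (v >_) (sym second) ∘ first⇒desc , desc⇒first ∘ subst (v >_) second
  where second = insert-punchIn fzero v τ fzero
hasDescentSet-insert v τ first⇒desc desc⇒first hd (fsuc i) =
  (λ { (there i∈S) → insert-isDescent v τ (proj₁ (hd i) i∈S) }) ,
  there ∘ proj₂ (hd i) ∘ isDescent-insert v τ

hasDescentSet-insert-top : {S : Subset m} (τ : Permutation′ (suc m)) → HasDescentSet S τ →
                           HasDescentSet (inside ∷ S) (insert fzero (fromℕ (suc m)) τ)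
hasDescentSet-insert-top τ = hasDescentSet-insert (fromℕ _) τ
  (λ _ → Finₚ.≤∧≢⇒< (Finₚ.≤fromℕ _) (Finₚ.punchInᵢ≢i _ _)) (λ _ → here)

hasDescentSet-insert-bottom : {S : Subset m} (τ : Permutation′ (suc m)) → HasDescentSet S τ →
                              HasDescentSet (outside ∷ S) (insert fzero fzero τ)
hasDescentSet-insert-bottom τ = hasDescentSet-insert fzero τ (λ ()) (λ ())

canonical : Subset m → Permutation′ (suc m)
canonical []            = id
canonical (inside ∷ S)  = insert fzero (fromℕ _) (canonical S)
canonical (outside ∷ S) = insert fzero fzero (canonical S)

canonical-hasDescentSet : (S : Subset m) → HasDescentSet S (canonical S)
canonical-hasDescentSet []            ()
canonical-hasDescentSet (inside ∷ S)  =
  hasDescentSet-insert-top (canonical S) (canonical-hasDescentSet S)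
canonical-hasDescentSet (outside ∷ S) =
  hasDescentSet-insert-bottom (canonical S) (canonical-hasDescentSet S)

insert-≢ₚ : (v : Fin (suc n)) (τ τ′ : Permutation′ n) →
            τ ≢ₚ τ′ → insert fzero v τ ≢ₚ insert fzero v τ′
insert-≢ₚ v τ τ′ τ≢τ′ vτ≈vτ′ = τ≢τ′ λ k → Finₚ.punchIn-injective v _ _
  (trans (sym (insert-punchIn fzero v τ k)) (trans (vτ≈vτ′ (fsuc k)) (insert-punchIn fzero v τ′ k)))

DistinctPair : Subset m → Set
DistinctPair S = ∃₂ λ σ ρ → HasDescentSet S σ × HasDescentSet S ρ × σ ≢ₚ ρ

distinctPair-inside : {S : Subset m} → ∃ (_∉ inside ∷ S) → DistinctPair (inside ∷ S)
distinctPair-inside (fzero , 0∉) = contradiction here 0∉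
distinctPair-inside {S = inside ∷ S} (fsuc i , i+1∉) =
  let σ , ρ , hσ , hρ , σ≢ρ = distinctPair-inside {S = S} (i , i+1∉ ∘ there)
  in  insert fzero (fromℕ _) σ , insert fzero (fromℕ _) ρ ,
      hasDescentSet-insert-top σ hσ , hasDescentSet-insert-top ρ hρ , insert-≢ₚ (fromℕ _) σ ρ σ≢ρ
-- Both permutations begin with a descent onto the value 1: one from n, the other from 2.
distinctPair-inside {S = outside ∷ S} _ =
  insert fzero (fromℕ _) τ , insert fzero (fsuc fzero) τ ,
  hasDescentSet-insert-top τ hτ ,
  hasDescentSet-insert (fsuc fzero) τ (λ _ → s≤s z≤n) (λ _ → here) hτ ,
  λ σ≈ρ → contradiction (σ≈ρ fzero) λ ()
  where
  τ  = insert fzero fzero (canonical S)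
  hτ = hasDescentSet-insert-bottom (canonical S) (canonical-hasDescentSet S)

distinctPair : {S : Subset m} → Nonempty S → ∃ (_∉ S) → DistinctPair S
distinctPair {S = inside ∷ S}  _         missing = distinctPair-inside missing
distinctPair {S = outside ∷ S} (i , i∈S) _       =
  -- ∁ (outside ∷ S) computes to inside ∷ ∁ S.
  let σ , ρ , hσ , hρ , σ≢ρ = distinctPair-inside (i , x∈p⇒x∉∁p i∈S)
  in  complement σ , complement ρ ,
      hasDescentSet-complement (complementary-∁ (outside ∷ S)) σ hσ ,
      hasDescentSet-complement (complementary-∁ (outside ∷ S)) ρ hρ , complement-≢ₚ σ ρ σ≢ρ

attained⇒≤ : {S : Subset m} {k : ℕ} → Attained S k → k ≤ m
attained⇒≤ (σ , ρ , _ , _ , _ , refl) = dℓ≤pred[n] σ ρ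

isMaxDist : (S : Subset m) → DistinctPair S → ∃ (IsMaxDist S)
isMaxDist {m} S (σ , ρ , hσ , hρ , σ≢ρ) =
  let k , attained , maximal =
        greatest (attained? S) m attained⇒≤ (dℓ σ ρ , σ , ρ , hσ , hρ , σ≢ρ , refl)
  in  k , attained , λ τ π hτ hπ τ≢π → maximal (τ , π , hτ , hπ , τ≢π , refl)

theorem5p5 : ∀ (m : ℕ) (S : Subset m) → Nonempty S → ∃ (λ i → i ∉ S) →
    ∃ (λ k → IsMaxDist S k × IsMaxDist (∁ S) k)
theorem5p5 m S nonempty missing =
  let k , maxS = isMaxDist S (distinctPair nonempty missing)
  in  k , maxS , isMaxDist-∁ S maxS
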